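{- Let $\alpha$ be a composition, $w\in CRHW_n$ with $w(\alpha)=\beta\neq0$, and let $\tau$ be the filling of $\beta/\!\!/\alpha$ corresponding to $w$. Then for every $j\ge2$, the entries of $\tau$ in column $j$ strictly decrease from top to bottom.
   Context: A composition is a finite sequence of positive integers; its diagram has $\alpha_i$ left-justified boxes in row $i$, rows numbered top to bottom. Box-adding operators: $\mathfrak{t}_1(\alpha)=(1,\alpha_1,\ldots,\alpha_k)$ (adding a new top row of one box, all previous rows moving down one); for $i\ge2$, $\mathfrak{t}_i(\alpha)$ adds one box at the end of the topmost row of length $i-1$ (so in column $i$) if one exists, and is $0$ otherwise; $\mathfrak{t}_i(0)=0$. A word $w=\mathfrak{t}_{i_1}\cdots\mathfrak{t}_{i_n}$ acts by applying $\mathfrak{t}_{i_n}$ first, then $\mathfrak{t}_{i_{n-1}}$, etc. It is a reverse hookword if for some $0\le k\le n-1$, $i_1\le\cdots\le i_{k+1}>i_{k+2}>\cdots>i_n$, and connected if $\{i_1,\ldots,i_n\}$ is a set of consecutive integers; $CRHW_n$ is the set of connected reverse hookwords of length $n$. If $w(\alpha)=\beta\ne0$, the boxes added during the successive applications (tracked as rows shift down under $\mathfrak{t}_1$) form the skew shape $\beta/\!\!/\alpha$ (the diagram of $\beta$ with the diagram of $\alpha$ removed from its bottom $l(\alpha)$ rows); the filling $\tau$ of $\beta/\!\!/\alpha$ corresponding to $w$ places $n-m+1$ in the $m$-th box added ($m=1,\ldots,n$). This $\tau$ is a standard reverse composition tableau of shape $\beta/\!\!/\alpha$. -}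

module Defs where

open import Data.Nat using (ℕ; zero; suc; _+_; _∸_; _≤_; _<_; _>_)
open import Data.List using (List; []; _∷_; _++_; [_]; length; reverse; map; replicate)
open import Data.List.Relation.Unary.All using (All)
open import Data.List.Relation.Unary.Linked using (Linked)
open import Data.List.Membership.Propositional using (_∈_)
open import Data.Maybe using (Maybe; just; nothing; _>>=_)
open import Data.Product using (Σ; _×_; ∃; ∃-syntax)
open import Relation.Binary.PropositionalEquality using (_≡_)
open import Relation.Nullary using (yes; no)
open import Data.Nat using (_≟_)

IsComposition : List ℕ → Set
IsComposition α = All (λ a → 0 < a) α

-- A diagram whose boxes are tracked: each row (top to bottom) is a list of
-- cells (left to right); 'nothing' = a box of the original α,
-- 'just m' = the m-th box added.
Row : Set
Row = List (Maybe ℕ)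

Diagram : Set
Diagram = List Row

diagramOf : List ℕ → Diagram
diagramOf α = map (λ a → replicate a nothing) α

appendTopmost : ℕ → ℕ → Diagram → Maybe Diagram
appendTopmost k m [] = nothing
appendTopmost k m (r ∷ d) with length r ≟ k
... | yes _ = just ((r ++ [ just m ]) ∷ d)
... | no _ = Data.Maybe.map (r ∷_) (appendTopmost k m d)

-- the operator t_i, recording the added box as the m-th one;
-- 'nothing' stands for the zero result. (t_0 is not defined; we return 0.)
tOp : ℕ → ℕ → Diagram → Maybe Diagram
tOp zero m d = nothing
tOp (suc zero) m d = just ([ just m ] ∷ d)
tOp (suc (suc k)) m d = appendTopmost (suc k) m d

applyFrom : List ℕ → ℕ → Diagram → Maybe Diagram
applyFrom [] m d = just d
applyFrom (i ∷ is) m d = tOp i m d >>= applyFrom is (suc m)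

-- w = t_{i_1} ... t_{i_n} acting on α: t_{i_n} is applied first (adds box 1),
-- ..., t_{i_1} last (adds box n).  The result tracks the added boxes.
act : List ℕ → List ℕ → Maybe Diagram
act w α = applyFrom (reverse w) 1 (diagramOf α)

shape : Diagram → List ℕ
shape d = map length d

IsReverseHookword : List ℕ → Set
IsReverseHookword w =
  ∃[ xs ] ∃[ x ] ∃[ ys ]
    (w ≡ xs ++ (x ∷ ys)) × Linked _≤_ (xs ++ [ x ]) × Linked _>_ (x ∷ ys)

IsConnected : List ℕ → Set
IsConnected w =
  ∃[ a ] ∃[ b ] (All (λ i → a ≤ i × i ≤ b) w) × (∀ c → a ≤ c → c ≤ b → c ∈ w)

-- CRHW_n (letters are indices of operators t_i, so i ≥ 1)
CRHW : ℕ → List ℕ → Set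
CRHW n w = length w ≡ n × All (λ i → 1 ≤ i) w × IsReverseHookword w × IsConnected w

-- 1-indexed lookup
nth : {A : Set} → List A → ℕ → Maybe A
nth [] _ = nothing
nth (x ∷ xs) zero = nothing
nth (x ∷ xs) (suc zero) = just x
nth (x ∷ xs) (suc (suc k)) = nth xs (suc k)

-- entry of the filling τ (for a word of length n) in row r, column c
-- (1-indexed, rows top to bottom): the m-th added box holds n - m + 1;
-- 'nothing' if the position is not a box of the skew shape β//α.
entry : ℕ → Diagram → ℕ → ℕ → Maybe ℕ
entry n d r c with nth d r
... | nothing = nothing
... | just row with nth row c
...   | just (just m) = just (n ∸ m + 1)
...   | _ = nothing

-- The m-th added box holds n - m + 1, so the claim is that in every column j ≥ 2 a box lies
-- below another only if it was added later.  A reverse hookword acts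
-- as a weakly increasing run of operators followed by a weakly decreasing one.  Appending to the
-- topmost row of length j - 1 keeps column j increasing downwards provided no lower row already
-- has a box in column j, i.e. provided every row of length j - 1 "blocks" column j for the rows
-- below it.  During the increasing run every column right of the last letter is still empty, so
-- all columns are blocked; during the decreasing run only the columns up to the current letter
-- can still be reached, and those stay blocked.
module Submission where

open import Defs
open import Data.Nat using (ℕ; zero; suc; _+_; _∸_; _≤_; _<_; _>_; _≥_; z≤n; s≤s; _≟_)
open import Data.Nat.Properties
  using ( ≤-refl; ≤-trans; ≤-pred; <⇒≤; ≤-<-trans; m<n⇒m<1+n; 1+n≰n; suc-injective
        ; +-identityʳ; +-suc; +-monoˡ-<; ∸-monoʳ-<)
open import Data.List using (List; []; _∷_; _++_; [_]; length; reverse; reverseAcc; replicate)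
open import Data.List.Properties using (reverse-++; length-reverse)
open import Data.List.Relation.Unary.All as All using (All; []; _∷_)
open import Data.List.Relation.Unary.All.Properties using (replicate⁺; map⁺)
open import Data.List.Relation.Unary.AllPairs as AllPairs using (AllPairs; []; _∷_)
open import Data.List.Relation.Unary.Linked as Linked using (Linked; []; [-]; _∷_)
open import Data.Maybe using (Maybe; just; nothing; _>>=_)
open import Data.Maybe.Properties using (just-injective)
open import Data.Product using (_×_; _,_; ∃-syntax; proj₁; proj₂)
open import Data.Sum using (_⊎_; inj₁; inj₂)
open import Data.Empty using (⊥-elim)
open import Data.Unit using (tt)
open import Function using (flip)
open import Relation.Unary using (U)
open import Relation.Nullary using (¬_; yes; no)
open import Relation.Binary.PropositionalEquality using (_≡_; _≢_; refl; sym; trans; cong; subst)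

nth-∷ʳ : ∀ {A : Set} (xs : List A) {x y : A} c → nth (xs ++ [ x ]) c ≡ just y →
  (c ≡ suc (length xs) × x ≡ y) ⊎ nth xs c ≡ just y
nth-∷ʳ []       (suc zero)    e = inj₁ (refl , just-injective e)
nth-∷ʳ (_ ∷ xs) (suc zero)    e = inj₂ e
nth-∷ʳ (_ ∷ xs) (suc (suc c)) e with nth-∷ʳ xs (suc c) e
... | inj₁ (c≡ , x≡y) = inj₁ (cong suc c≡ , x≡y)
... | inj₂ e′          = inj₂ e′

nth-All : ∀ {A : Set} {P : A → Set} {xs : List A} c {y} → All P xs → nth xs c ≡ just y → P y
nth-All (suc zero)    (px ∷ _)  refl = px
nth-All (suc (suc c)) (_ ∷ pxs) e    = nth-All (suc c) pxs e

nth-AllPairs : ∀ {A : Set} {T : A → A → Set} {xs : List A} {r₁ r₂ u l} →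
  AllPairs T xs → r₁ < r₂ → nth xs r₁ ≡ just u → nth xs r₂ ≡ just l → T u l
nth-AllPairs {r₁ = suc zero}    {suc (suc r₂)} (tx ∷ _)  _         refl e₂ = nth-All (suc r₂) tx e₂
nth-AllPairs {r₁ = suc (suc _)} {suc (suc _)}  (_ ∷ txs) (s≤s r₁<r₂) e₁ e₂ =
  nth-AllPairs txs r₁<r₂ e₁ e₂
nth-AllPairs {r₁ = suc zero}    {suc zero}     _         (s≤s ())  _    _
nth-AllPairs {r₁ = suc (suc _)} {suc zero}     _         (s≤s ())  _    _
nth-AllPairs {xs = _ ∷ _}       {zero}         _         _         ()   _

length-∷ʳ : ∀ {A : Set} (xs : List A) {x : A} → length (xs ++ [ x ]) ≡ suc (length xs)
length-∷ʳ []       = refl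
length-∷ʳ (_ ∷ xs) = cong suc (length-∷ʳ xs)

Linked-reverse : ∀ {A : Set} {R : A → A → Set} {xs} → Linked R xs → Linked (flip R) (reverse xs)
Linked-reverse []              = []
Linked-reverse {R = R} {xs = _ ∷ _} rs = linked-reverseAcc [-] rs
  where
  linked-reverseAcc : ∀ {y acc ys} → Linked (flip R) (y ∷ acc) → Linked R (y ∷ ys) →
    Linked (flip R) (reverseAcc (y ∷ acc) ys)
  linked-reverseAcc acc [-]      = acc
  linked-reverseAcc acc (r ∷ rs) = linked-reverseAcc (r ∷ acc) rs

bind-just : ∀ {A B : Set} {mx : Maybe A} {f : A → Maybe B} {y} → (mx >>= f) ≡ just y →
  ∃[ x ] mx ≡ just x × f x ≡ just y
bind-just {mx = just x} e = x , refl , e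

AddedAt : Row → ℕ → ℕ → Set
AddedAt row c m = nth row c ≡ just (just m)

ColumnFree : ℕ → Row → Set
ColumnFree c row = ∀ m → ¬ AddedAt row c m

Unlabelled : Row → Set
Unlabelled row = ∀ c → ColumnFree c row

FreeBeyond : ℕ → Row → Set
FreeBeyond B row = ∀ c → B < c → ColumnFree c row

LabelsBelow : ℕ → Row → Set
LabelsBelow M row = ∀ c m → AddedAt row c m → m < M

LabelsIncrease : Row → Row → Set
LabelsIncrease u l = ∀ c → 2 ≤ c → ∀ m m′ → AddedAt u c m → AddedAt l c m′ → m < m′

-- P is the set of columns that operators applied later may still extend a row into.
Blocks : (ℕ → Set) → Row → Row → Set
Blocks P u l = P (suc (length u)) → ColumnFree (suc (length u)) l

record Ordered (P : ℕ → Set) (u l : Row) : Set where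
  constructor ordered
  field
    increasing : LabelsIncrease u l
    blocking   : Blocks P u l

Ordered-weaken : ∀ {P Q : ℕ → Set} → (∀ {c} → Q c → P c) → ∀ {u l} → Ordered P u l → Ordered Q u l
Ordered-weaken Q⇒P (ordered increase block) = ordered increase λ q → block (Q⇒P q)

AddedAt-∷ʳ : ∀ row {m} c {m′} → AddedAt (row ++ [ just m ]) c m′ →
  (c ≡ suc (length row) × m ≡ m′) ⊎ AddedAt row c m′
AddedAt-∷ʳ row c box with nth-∷ʳ row c box
... | inj₁ (c≡ , m≡m′) = inj₁ (c≡ , just-injective m≡m′)
... | inj₂ box′        = inj₂ box′

AddedAt-singleton : ∀ {m} c {m′} → AddedAt [ just m ] c m′ → c ≡ 1 × m ≡ m′
AddedAt-singleton (suc zero) refl = refl , refl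

replicate-Unlabelled : ∀ a → Unlabelled (replicate a nothing)
replicate-Unlabelled a c m box with () ← nth-All {P = _≡ nothing} c (replicate⁺ a refl) box

diagramOf-Unlabelled : ∀ α → All Unlabelled (diagramOf α)
diagramOf-Unlabelled α = map⁺ (All.universal replicate-Unlabelled α)

Unlabelled⇒Ordered : ∀ {P : ℕ → Set} {ds} → All Unlabelled ds → AllPairs (Ordered P) ds
Unlabelled⇒Ordered []                 = []
Unlabelled⇒Ordered {P} (_ ∷ unlabelleds) =
  All.map (λ unlabelled → ordered (λ c _ _ m′ _ box → ⊥-elim (unlabelled c m′ box)) λ _ → unlabelled _)
          unlabelleds
  ∷ Unlabelled⇒Ordered {P} unlabelleds

diagramOf-LabelsBelow : ∀ α {M} → All (LabelsBelow M) (diagramOf α)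
diagramOf-LabelsBelow α =
  All.map (λ unlabelled c m box → ⊥-elim (unlabelled c m box)) (diagramOf-Unlabelled α)

appendTopmost-All : ∀ {S S′ : Row → Set} {k m ds ds′} →
  (∀ r → S r → S′ r) → (∀ r → length r ≡ k → S r → S′ (r ++ [ just m ])) →
  All S ds → appendTopmost k m ds ≡ just ds′ → All S′ ds′
appendTopmost-All {k = k} {m} {r ∷ ds} keep grow (s ∷ ss) e with length r ≟ k
... | yes len≡k with refl ← e = grow r len≡k s ∷ All.map (keep _) ss
... | no _ with appendTopmost k m ds in e′
...   | just _ with refl ← e = keep r s ∷ appendTopmost-All keep grow ss e′

appendTopmost-AllPairs : ∀ {T T′ : Row → Row → Set} {F : Row → Set} {k m ds ds′} →
  (∀ u l → T u l → T′ u l) →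
  (∀ u → F u → length u ≢ k → ∀ r → length r ≡ k → T u r → T′ u (r ++ [ just m ])) →
  (∀ r l → F l → length r ≡ k → T r l → T′ (r ++ [ just m ]) l) →
  All F ds → AllPairs T ds → appendTopmost k m ds ≡ just ds′ → AllPairs T′ ds′
appendTopmost-AllPairs {k = k} {m} {r ∷ ds} keep above below (_ ∷ fs) (ts ∷ tss) e with length r ≟ k
... | yes len≡k with refl ← e =
  All.zipWith (λ (f , t) → below r _ f len≡k t) (fs , ts) ∷ AllPairs.map (keep _ _) tss
appendTopmost-AllPairs {k = k} {m} {r ∷ ds} keep above below (fr ∷ fs) (ts ∷ tss) e | no len≢k
  with appendTopmost k m ds in e′
... | just _ with refl ← e =
  appendTopmost-All (keep r) (above r fr len≢k) ts e′ ∷ appendTopmost-AllPairs keep above below fs tss e′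

LabelsBelow-suc : ∀ {M} row → LabelsBelow M row → LabelsBelow (suc M) row
LabelsBelow-suc _ below c m box = m<n⇒m<1+n (below c m box)

FreeBeyond-mono : ∀ {B C} → B ≤ C → ∀ row → FreeBeyond B row → FreeBeyond C row
FreeBeyond-mono B≤C _ free c C<c = free c (≤-<-trans B≤C C<c)

tOp-LabelsBelow : ∀ i {m d d′} → tOp i m d ≡ just d′ →
  All (LabelsBelow m) d → All (LabelsBelow (suc m)) d′
tOp-LabelsBelow (suc zero) refl labels = new ∷ All.map (λ {row} → LabelsBelow-suc row) labels
  where
  new : LabelsBelow (suc _) [ just _ ]
  new c m′ box with refl , refl ← AddedAt-singleton c box = ≤-refl
tOp-LabelsBelow (suc (suc k)) {m} e labels = appendTopmost-All LabelsBelow-suc grown labels e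
  where
  grown : ∀ row → length row ≡ suc k → LabelsBelow m row → LabelsBelow (suc m) (row ++ [ just m ])
  grown row _ below c m′ box with AddedAt-∷ʳ row c box
  ... | inj₁ (_ , refl) = ≤-refl
  ... | inj₂ box′       = m<n⇒m<1+n (below c m′ box′)

tOp-FreeBeyond : ∀ {B} i {m d d′} → B ≤ i → tOp i m d ≡ just d′ →
  All (FreeBeyond B) d → All (FreeBeyond i) d′
tOp-FreeBeyond (suc zero) B≤i refl frees = new ∷ All.map (λ {row} → FreeBeyond-mono B≤i row) frees
  where
  new : FreeBeyond 1 [ just _ ]
  new c 1<c m′ box with refl , _ ← AddedAt-singleton c box = 1+n≰n 1<c
tOp-FreeBeyond (suc (suc k)) B≤i e frees = appendTopmost-All (FreeBeyond-mono B≤i) grown frees e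
  where
  grown : ∀ row → length row ≡ suc k → FreeBeyond _ row → FreeBeyond (suc (suc k)) (row ++ [ just _ ])
  grown row len≡ free c i<c m′ box with AddedAt-∷ʳ row c box
  ... | inj₁ (refl , _) = 1+n≰n (subst (λ n → suc (suc (suc k)) ≤ suc n) len≡ i<c)
  ... | inj₂ box′       = free c (≤-<-trans B≤i i<c) m′ box′

tOp-Ordered : ∀ {P Q : ℕ → Set} i {m d d′} → (∀ {c} → Q c → P c) → P i →
  All (λ row → Q (suc i) → ColumnFree (suc i) row) d → All (LabelsBelow m) d →
  AllPairs (Ordered P) d → tOp i m d ≡ just d′ → AllPairs (Ordered Q) d′
tOp-Ordered {Q = Q} (suc zero) {m} Q⇒P _ frees _ pairs refl =
  All.map (λ {l} → new l) frees ∷ AllPairs.map (Ordered-weaken Q⇒P) pairs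
  where
  new : ∀ l → (Q 2 → ColumnFree 2 l) → Ordered Q [ just m ] l
  new _ free = ordered (λ c 2≤c _ _ box _ → ⊥-elim (1+n≰n (subst (2 ≤_) (column≡1 c box) 2≤c))) free
    where
    column≡1 : ∀ c {m′} → AddedAt [ just m ] c m′ → c ≡ 1
    column≡1 c box = proj₁ (AddedAt-singleton c box)
tOp-Ordered {P} {Q} i@(suc (suc k)) {m} Q⇒P Pi frees labels pairs e =
  appendTopmost-AllPairs (λ _ _ → Ordered-weaken Q⇒P) above below (All.zip (labels , frees)) pairs e
  where
  above : ∀ u → LabelsBelow m u × _ → length u ≢ suc k → ∀ r → length r ≡ suc k →
    Ordered P u r → Ordered Q u (r ++ [ just m ])
  above u (labelsᵤ , _) len≢ r len≡ (ordered increase block) = ordered increase′ block′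
    where
    increase′ : LabelsIncrease u (r ++ [ just m ])
    increase′ c 2≤c m₁ m₂ boxᵤ boxᵣ with AddedAt-∷ʳ r c boxᵣ
    ... | inj₁ (_ , refl) = labelsᵤ c m₁ boxᵤ
    ... | inj₂ boxᵣ′      = increase c 2≤c m₁ m₂ boxᵤ boxᵣ′
    block′ : Blocks Q u (r ++ [ just m ])
    block′ q m′ box with AddedAt-∷ʳ r (suc (length u)) box
    ... | inj₁ (c≡ , _) = len≢ (trans (suc-injective c≡) len≡)
    ... | inj₂ box′     = block (Q⇒P q) m′ box′
  below : ∀ r l → _ × (Q (suc i) → ColumnFree (suc i) l) → length r ≡ suc k →
    Ordered P r l → Ordered Q (r ++ [ just m ]) l
  below r l (_ , free) len≡ (ordered increase block) = ordered increase′ block′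
    where
    increase′ : LabelsIncrease (r ++ [ just m ]) l
    increase′ c 2≤c m₁ m₂ boxᵣ boxₗ with AddedAt-∷ʳ r c boxᵣ
    ... | inj₁ (refl , _) = ⊥-elim (block (subst (λ n → P (suc n)) (sym len≡) Pi) m₂ boxₗ)
    ... | inj₂ boxᵣ′      = increase c 2≤c m₁ m₂ boxᵣ′ boxₗ
    block′ : Blocks Q (r ++ [ just m ]) l
    block′ = subst (λ n → Q (suc n) → ColumnFree (suc n) l)
                   (sym (trans (length-∷ʳ r) (cong suc len≡))) free

applyFrom-++ : ∀ as {bs m d d′} → applyFrom (as ++ bs) m d ≡ just d′ →
  ∃[ d₁ ] applyFrom as m d ≡ just d₁ × applyFrom bs (m + length as) d₁ ≡ just d′
applyFrom-++ [] {bs} {m} {d} e =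
  d , refl , subst (λ k → applyFrom bs k d ≡ just _) (sym (+-identityʳ m)) e
applyFrom-++ (i ∷ as) {bs} {m} {d′ = d′} e with bind-just {mx = tOp i m _} e
... | d₀ , e₀ , e′ with applyFrom-++ as e′
...   | d₁ , e₁ , e₂ = d₁ , subst (λ x → (x >>= applyFrom as (suc m)) ≡ just d₁) (sym e₀) e₁ ,
                       subst (λ k → applyFrom bs k d₁ ≡ just d′) (sym (+-suc m (length as))) e₂

applyFrom-LabelsBelow : ∀ zs {m d d′} → applyFrom zs m d ≡ just d′ → All (LabelsBelow m) d →
  All (LabelsBelow (m + length zs)) d′
applyFrom-LabelsBelow [] {m} refl labels =
  subst (λ k → All (LabelsBelow k) _) (sym (+-identityʳ m)) labels
applyFrom-LabelsBelow (z ∷ zs) {m} {d′ = d′} e labels with bind-just {mx = tOp z m _} e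
... | _ , e₁ , e₂ = subst (λ k → All (LabelsBelow k) d′) (sym (+-suc m (length zs)))
                          (applyFrom-LabelsBelow zs e₂ (tOp-LabelsBelow z e₁ labels))

applyFrom-invariant : ∀ (I : ℕ → Diagram → Set) {R : ℕ → ℕ → Set} →
  (∀ {B} z {m d d′} → R B z → I B d → All (LabelsBelow m) d → tOp z m d ≡ just d′ → I z d′) →
  ∀ {B} zs {m d d′} → Linked R (B ∷ zs) → I B d → All (LabelsBelow m) d →
  applyFrom zs m d ≡ just d′ → ∃[ B′ ] I B′ d′
applyFrom-invariant I step []       _        inv _      refl = _ , inv
applyFrom-invariant I step (z ∷ zs) (r ∷ rs) inv labels e with bind-just e
... | _ , e₁ , e₂ =
  applyFrom-invariant I step zs rs (step z r inv labels e₁) (tOp-LabelsBelow z e₁ labels) e₂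

Ascending : ℕ → Diagram → Set
Ascending B d = AllPairs (Ordered U) d × All (FreeBeyond B) d

Descending : ℕ → Diagram → Set
Descending B d = AllPairs (Ordered (_≤ B)) d

ascending-step : ∀ {B} z {m d d′} → B ≤ z → Ascending B d → All (LabelsBelow m) d →
  tOp z m d ≡ just d′ → Ascending z d′
ascending-step z B≤z (pairs , frees) labels e =
  tOp-Ordered z (λ q → q) tt (All.map (λ free _ → free (suc z) (s≤s B≤z)) frees) labels pairs e ,
  tOp-FreeBeyond z B≤z e frees

descending-step : ∀ {B} z {m d d′} → B ≥ z → Descending B d → All (LabelsBelow m) d →
  tOp z m d ≡ just d′ → Descending z d′
descending-step z z≤B pairs labels e =
  tOp-Ordered z (λ c≤z → ≤-trans c≤z z≤B) z≤B unreachable labels pairs e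
  where
  unreachable : All (λ row → suc z ≤ z → ColumnFree (suc z) row) _
  unreachable = All.universal (λ _ 1+z≤z → ⊥-elim (1+n≰n 1+z≤z)) _

ascending-run : ∀ α zs {d} → Linked _≤_ zs → applyFrom zs 1 (diagramOf α) ≡ just d →
  AllPairs (Ordered U) d
ascending-run α zs rising e =
  proj₁ (proj₂ (applyFrom-invariant Ascending ascending-step zs (from-zero rising) initial
                                    (diagramOf-LabelsBelow α) e))
  where
  unlabelled : All Unlabelled (diagramOf α)
  unlabelled = diagramOf-Unlabelled α
  initial : Ascending 0 (diagramOf α)
  initial = Unlabelled⇒Ordered unlabelled , All.map (λ u c _ → u c) unlabelled
  from-zero : ∀ {zs} → Linked _≤_ zs → Linked _≤_ (0 ∷ zs)
  from-zero []             = [-]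
  from-zero {_ ∷ _} rising = z≤n ∷ rising

descending-run : ∀ {B} zs {m d d′} → Linked _≥_ (B ∷ zs) → Descending B d →
  All (LabelsBelow m) d → applyFrom zs m d ≡ just d′ → AllPairs LabelsIncrease d′
descending-run zs falling pairs labels e
  with _ , pairs′ ← applyFrom-invariant Descending descending-step zs falling pairs labels e
  = AllPairs.map Ordered.increasing pairs′

act-LabelsBelow : ∀ α w {d} → act w α ≡ just d → All (LabelsBelow (suc (length w))) d
act-LabelsBelow α w {d} e =
  subst (λ n → All (LabelsBelow (suc n)) d) (length-reverse w)
        (applyFrom-LabelsBelow (reverse w) e (diagramOf-LabelsBelow α))

act-reverseHookword : ∀ α {w d} → IsReverseHookword w → act w α ≡ just d → AllPairs LabelsIncrease d
act-reverseHookword α {d = d} (xs , x , ys , refl , up , down) e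
  with d₁ , e₁ , e₂ ← applyFrom-++ (reverse (x ∷ ys))
                        (subst (λ v → applyFrom v 1 (diagramOf α) ≡ just d) (reverse-++ xs (x ∷ ys)) e)
  = descending-run (reverse xs) peak (AllPairs.map (Ordered-weaken _) (ascending-run α _ rising e₁))
                   (applyFrom-LabelsBelow (reverse (x ∷ ys)) e₁ (diagramOf-LabelsBelow α)) e₂
  where
  rising : Linked _≤_ (reverse (x ∷ ys))
  rising = Linked.map <⇒≤ (Linked-reverse down)
  peak : Linked _≥_ (x ∷ reverse xs)
  peak = subst (Linked _≥_) (reverse-++ xs [ x ]) (Linked-reverse up)

entry-inverse : ∀ n d r c {a} → entry n d r c ≡ just a →
  ∃[ row ] ∃[ m ] nth d r ≡ just row × AddedAt row c m × n ∸ m + 1 ≡ a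
entry-inverse n d r c e with nth d r
... | just row with nth row c in cell≡
...   | just (just m) with refl ← e = row , m , refl , cell≡ , refl

lemma5p5 : (α : List ℕ) → IsComposition α → (n : ℕ) → (w : List ℕ) → CRHW n w →
    (d : Diagram) → act w α ≡ just d →
    (j : ℕ) → 2 ≤ j → (r₁ r₂ : ℕ) → r₁ < r₂ → (a b : ℕ) →
    entry n d r₁ j ≡ just a → entry n d r₂ j ≡ just b → a > b
lemma5p5 α _ n w (length≡n , _ , hookword , _) d act≡d j 2≤j r₁ r₂ r₁<r₂ a b τ₁ τ₂
  with _ , m₁ , row₁ , box₁ , refl ← entry-inverse n d r₁ j τ₁
     | _ , m₂ , row₂ , box₂ , refl ← entry-inverse n d r₂ j τ₂
  = +-monoˡ-< 1 (∸-monoʳ-< m₁<m₂ m₂≤n)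
  where
  m₁<m₂ : m₁ < m₂
  m₁<m₂ = nth-AllPairs increasing r₁<r₂ row₁ row₂ j 2≤j m₁ m₂ box₁ box₂
    where
    increasing : AllPairs LabelsIncrease d
    increasing = act-reverseHookword α hookword act≡d
  m₂≤n : m₂ ≤ n
  m₂≤n = subst (m₂ ≤_) length≡n (≤-pred (nth-All r₂ bounded row₂ j m₂ box₂))
    where
    bounded : All (LabelsBelow (suc (length w))) d
    bounded = act-LabelsBelow α w act≡d
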